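{- Let $G$ be a finite simple graph with star number $\gamma(G)=k$. Then there exists a left-free $k$-witness of $G$ if and only if there exists a right-free $k$-witness of $G$.
   Context: All graphs are finite, simple and undirected. A graph $G=(V,E)$ is a star-$k$-PCG if there exist a weight function $w:V\to\mathbb{R}^+$ and $k$ pairwise disjoint intervals $I_1,\dots,I_k$ such that for distinct $u,v\in V$, $uv\in E$ if and only if $w(u)+w(v)\in\bigcup_i I_i$; the vertex-weighted graph $G^w$ with these intervals is a $k$-witness of $G$. Intervals are written $I_i=[a_i,b_i]$ with $b_i<a_{i+1}$. The star number $\gamma(G)$ is the least positive integer $k$ such that $G$ is a star-$k$-PCG. For distinct $u,v$, $w(uv)=w(u)+w(v)$. For $\gamma(G)=k$, a $k$-witness $G^w$ is left-free if every non-edge $e$ (pair of distinct non-adjacent vertices) satisfies $w(e)>b_1$, and right-free if every non-edge $e$ satisfies $w(e)<a_k$.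
   Formalization: The vertex weights of each k-witness are positive rationals instead of positive reals, and its interval endpoints are rational, so the star number γ(G) is also taken over ℚ. -}

module Defs where

open import Data.Nat using (ℕ; zero; suc)
import Data.Nat as ℕ
open import Data.Fin using (Fin; toℕ; fromℕ)
open import Data.Rational using (ℚ; 0ℚ; _+_; _<_; _≤_)
open import Data.Product using (Σ; ∃; _×_)
open import Relation.Nullary using (¬_)
open import Relation.Binary.PropositionalEquality using (_≡_; _≢_)
open import Function.Bundles using (_⇔_)

record Graph (n : ℕ) : Set₁ where
  field
    Adj     : Fin n → Fin n → Set
    symAdj  : ∀ {u v} → Adj u v → Adj v u
    irrefl  : ∀ {u} → ¬ Adj u u
open Graph public

record Witness {n : ℕ} (G : Graph n) (k : ℕ) : Set where
  field
    w       : Fin n → ℚ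
    w-pos   : ∀ v → 0ℚ < w v
    a b     : Fin k → ℚ
    a≤b     : ∀ i → a i ≤ b i
    ordered : ∀ (i j : Fin k) → toℕ j ≡ suc (toℕ i) → b i < a j
    correct : ∀ (u v : Fin n) → u ≢ v →
              Adj G u v ⇔ (∃ λ (i : Fin k) → (a i ≤ w u + w v) × (w u + w v ≤ b i))
open Witness public

IsStarPCG : {n : ℕ} → Graph n → ℕ → Set
IsStarPCG G k = Witness G k

IsStarNumber : {n : ℕ} → Graph n → ℕ → Set
IsStarNumber G k =
  (1 ℕ.≤ k) × IsStarPCG G k × (∀ j → 1 ℕ.≤ j → j ℕ.< k → ¬ IsStarPCG G j)

LeftFree : {n m : ℕ} {G : Graph n} → Witness G (suc m) → Set
LeftFree {n} {m} {G} W =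
  ∀ (u v : Fin n) → u ≢ v → ¬ Adj G u v → b W Fin.zero < w W u + w W v
  where import Data.Fin as Fin

RightFree : {n m : ℕ} {G : Graph n} → Witness G (suc m) → Set
RightFree {n} {m} {G} W =
  ∀ (u v : Fin n) → u ≢ v → ¬ Adj G u v → w W u + w W v < a W (fromℕ m)

{-# OPTIONS --safe #-}
-- Reflect everything: choose C above all weights and replace w by C − w, the
-- intervals [a_i, b_i] by [2C − b_{k+1−i}, 2C − a_{k+1−i}]. Weights stay
-- positive, every pair sum s becomes 2C − s, so the edge relation is unchanged,
-- and the interval order is reversed: a non-edge sum beyond b_1 is sent below
-- the new a_k, and vice versa.
module Submission where

open import Defs
open import Data.Nat using (ℕ; zero; suc; _∸_)
open import Data.Nat.Properties using (+-∸-assoc)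
open import Data.Fin using (Fin; zero; suc; toℕ; fromℕ; opposite)
open import Data.Fin.Properties using (opposite-prop; opposite-involutive; toℕ<n)
open import Data.Rational using (ℚ; 0ℚ; 1ℚ; _+_; _-_; -_; _<_; _≤_; _⊔_)
open import Data.Rational.Properties
  using ( +-identityʳ; +-inverseʳ; +-monoʳ-<; +-monoˡ-<; +-monoʳ-≤
        ; neg-antimono-<; neg-antimono-≤; positive⁻¹; <-≤-trans; p≤p⊔q; p≤q⊔p
        ; module ≤-Reasoning )
open import Data.Rational.Solver using (module +-*-Solver)
open import Data.Product using (Σ; ∃; _×_; _,_)
open import Function.Base using (_∘_)
open import Function.Bundles using (_⇔_; mk⇔)
open import Function.Construct.Composition using (_⇔-∘_)
open import Relation.Binary.PropositionalEquality
  using (_≡_; refl; sym; cong; subst; subst₂; module ≡-Reasoning)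

open +-*-Solver using (solve; _:+_; _:-_; _:=_)

p<p+1 : ∀ p → p < p + 1ℚ
p<p+1 p = subst (_< p + 1ℚ) (+-identityʳ p) (+-monoʳ-< p (positive⁻¹ 1ℚ))

p<q⇒0<q-p : ∀ {p q} → p < q → 0ℚ < q - p
p<q⇒0<q-p {p} {q} p<q = subst (_< q - p) (+-inverseʳ p) (+-monoˡ-< (- p) p<q)

sub-antimonoʳ-< : ∀ d {p q} → p < q → d - q < d - p
sub-antimonoʳ-< d p<q = +-monoʳ-< d (neg-antimono-< p<q)

sub-antimonoʳ-≤ : ∀ d {p q} → p ≤ q → d - q ≤ d - p
sub-antimonoʳ-≤ d p≤q = +-monoʳ-≤ d (neg-antimono-≤ p≤q)

p-[p-q]≡q : ∀ p q → p - (p - q) ≡ q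
p-[p-q]≡q = solve 2 (λ p q → p :- (p :- q) := q) refl

sub-cancelˡ-≤ : ∀ d {p q} → d - p ≤ d - q → q ≤ p
sub-cancelˡ-≤ d {p} {q} le = subst₂ _≤_ (p-[p-q]≡q d q) (p-[p-q]≡q d p) (sub-antimonoʳ-≤ d le)

[p-q]+[p-r]≡[p+p]-[q+r] : ∀ p q r → (p - q) + (p - r) ≡ (p + p) - (q + r)
[p-q]+[p-r]≡[p+p]-[q+r] = solve 3 (λ p q r → (p :- q) :+ (p :- r) := (p :+ p) :- (q :+ r)) refl

strict-upper-bound : ∀ {n} (f : Fin n → ℚ) → ∃ λ C → ∀ i → f i < C
strict-upper-bound {zero} f = 0ℚ , λ ()
strict-upper-bound {suc n} f with strict-upper-bound (f ∘ suc)
... | C , f∘suc<C = (f zero + 1ℚ) ⊔ C , λ where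
  zero    → <-≤-trans (p<p+1 (f zero)) (p≤p⊔q (f zero + 1ℚ) C)
  (suc i) → <-≤-trans (f∘suc<C i) (p≤q⊔p (f zero + 1ℚ) C)

opposite-consecutive : ∀ {k} (i j : Fin k) → toℕ j ≡ suc (toℕ i) →
                       toℕ (opposite i) ≡ suc (toℕ (opposite j))
opposite-consecutive {k} i j j≡1+i = begin
  toℕ (opposite i)        ≡⟨ opposite-prop i ⟩
  k ∸ suc (toℕ i)         ≡⟨ cong (k ∸_) j≡1+i ⟨
  k ∸ toℕ j               ≡⟨ +-∸-assoc 1 (toℕ<n j) ⟩
  suc (k ∸ suc (toℕ j))   ≡⟨ cong suc (opposite-prop j) ⟨
  suc (toℕ (opposite j))  ∎
  where open ≡-Reasoning

Covered : ∀ {k} → (Fin k → ℚ) → (Fin k → ℚ) → ℚ → Set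
Covered a b s = ∃ λ i → (a i ≤ s) × (s ≤ b i)

reflect-covered : ∀ {k} d (a b : Fin k → ℚ) s →
                  Covered a b s ⇔ Covered (λ i → d - b (opposite i)) (λ i → d - a (opposite i)) (d - s)
reflect-covered d a b s = mk⇔ to from
  where
  to : Covered a b s → Covered (λ i → d - b (opposite i)) (λ i → d - a (opposite i)) (d - s)
  to (i , a≤s , s≤b) = opposite i , subst (λ j → (d - b j ≤ d - s) × (d - s ≤ d - a j))
    (sym (opposite-involutive i)) (sub-antimonoʳ-≤ d s≤b , sub-antimonoʳ-≤ d a≤s)
  from : Covered (λ i → d - b (opposite i)) (λ i → d - a (opposite i)) (d - s) → Covered a b s
  from (i , ≤d-s , d-s≤) = opposite i , sub-cancelˡ-≤ d d-s≤ , sub-cancelˡ-≤ d ≤d-s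

reflect : ∀ {n k} {G : Graph n} (W : Witness G k) (C : ℚ) → (∀ v → w W v < C) → Witness G k
reflect {G = G} W C w<C = record
  { w       = λ v → C - w W v
  ; w-pos   = λ v → p<q⇒0<q-p (w<C v)
  ; a       = λ i → (C + C) - b W (opposite i)
  ; b       = λ i → (C + C) - a W (opposite i)
  ; a≤b     = λ i → sub-antimonoʳ-≤ (C + C) (a≤b W (opposite i))
  ; ordered = λ i j j≡1+i →
      sub-antimonoʳ-< (C + C) (ordered W (opposite j) (opposite i) (opposite-consecutive i j j≡1+i))
  ; correct = λ u v u≢v →
      subst (λ s → Adj G u v ⇔ Covered _ _ s) (sym ([p-q]+[p-r]≡[p+p]-[q+r] C (w W u) (w W v)))
        (reflect-covered (C + C) (a W) (b W) (w W u + w W v) ⇔-∘ correct W u v u≢v)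
  }

module _ {n m} {G : Graph n} (W : Witness G (suc m)) {C : ℚ} (w<C : ∀ v → w W v < C) where
  open ≤-Reasoning

  reflect-leftFree⇒rightFree : LeftFree W → RightFree (reflect W C w<C)
  reflect-leftFree⇒rightFree leftFree u v u≢v ¬uv = begin-strict
    (C - w W u) + (C - w W v)           ≡⟨ [p-q]+[p-r]≡[p+p]-[q+r] C (w W u) (w W v) ⟩
    (C + C) - (w W u + w W v)           <⟨ sub-antimonoʳ-< (C + C) (leftFree u v u≢v ¬uv) ⟩
    (C + C) - b W zero                  ≡⟨ cong (λ i → (C + C) - b W i) (opposite-involutive zero) ⟨
    (C + C) - b W (opposite (fromℕ m))  ∎

  reflect-rightFree⇒leftFree : RightFree W → LeftFree (reflect W C w<C)
  reflect-rightFree⇒leftFree rightFree u v u≢v ¬uv = begin-strict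
    (C + C) - a W (fromℕ m)    <⟨ sub-antimonoʳ-< (C + C) (rightFree u v u≢v ¬uv) ⟩
    (C + C) - (w W u + w W v)  ≡⟨ [p-q]+[p-r]≡[p+p]-[q+r] C (w W u) (w W v) ⟨
    (C - w W u) + (C - w W v)  ∎

lemma1 : ∀ (n : ℕ) (G : Graph n) (m : ℕ) → IsStarNumber G (suc m) →
           (Σ (Witness G (suc m)) LeftFree) ⇔ (Σ (Witness G (suc m)) RightFree)
lemma1 n G m _ = mk⇔ to from
  where
  to : Σ (Witness G (suc m)) LeftFree → Σ (Witness G (suc m)) RightFree
  to (W , leftFree) with strict-upper-bound (w W)
  ... | C , w<C = reflect W C w<C , reflect-leftFree⇒rightFree W w<C leftFree
  from : Σ (Witness G (suc m)) RightFree → Σ (Witness G (suc m)) LeftFree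
  from (W , rightFree) with strict-upper-bound (w W)
  ... | C , w<C = reflect W C w<C , reflect-rightFree⇒leftFree W w<C rightFree
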